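{- Let $\pi$ be an ordering of $n$ agents and $x$ a 1D-mobility schedule from $\pi$ such that $\mathcal{G}_{\pi,x}=((V,E),\lambda)$ is a temporal clique. Let $a,b,c\in V$ be three nodes such that $\lambda(ac)$ is the median of $\{\lambda(ab),\lambda(ac),\lambda(bc)\}$. Then $b$ lies between $a$ and $c$ in the initial ordering $\pi$, i.e. either $a,b,c$ or $c,b,a$ is a subsequence of $\pi$.
   Context: 1D-mobility model: $n$ agents lie on a line in an initial ordering $\pi$ (a sequence listing all agents). A 1D-mobility schedule from $\pi$ is a sequence $x=(x_1,\dots,x_T)$ of pairs of agents, where, setting $\pi_0=\pi$, each $x_t=\{u,v\}$ consists of two agents that are consecutive in $\pi_{t-1}$, and $\pi_t$ is obtained from $\pi_{t-1}$ by exchanging $u$ and $v$. The temporal graph $\mathcal{G}_{\pi,x}$ has vertex set the agents and an edge $uv$ with label $\lambda(uv)=t$ whenever $x_t=uv$. It is a temporal clique when every pair of agents appears in exactly one $x_t$ (so each edge of the complete graph has a single label, labels being pairwise distinct). -}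

module Defs where

open import Data.Nat using (ℕ; _<_)
open import Data.Fin using (Fin; toℕ)
open import Data.List using (List; []; _∷_; length; lookup)
open import Data.List.Relation.Unary.Unique.Propositional using (Unique)
open import Data.List.Membership.Propositional using (_∈_)
open import Data.Product using (_×_; _,_; ∃)
open import Data.Sum using (_⊎_)
open import Relation.Binary.PropositionalEquality using (_≡_)
open import Relation.Nullary using (¬_)

IsOrdering : (n : ℕ) → List (Fin n) → Set
IsOrdering n π = Unique π × (∀ (v : Fin n) → v ∈ π)

data AdjSwap {n : ℕ} : List (Fin n) → Fin n → Fin n → List (Fin n) → Set where
  here  : ∀ {u v l} → AdjSwap (u ∷ v ∷ l) u v (v ∷ u ∷ l)
  there : ∀ {w u v l l'} → AdjSwap l u v l' → AdjSwap (w ∷ l) u v (w ∷ l')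

SwapPair : {n : ℕ} → List (Fin n) → Fin n × Fin n → List (Fin n) → Set
SwapPair l (u , v) l' = AdjSwap l u v l' ⊎ AdjSwap l v u l'

data Schedule {n : ℕ} : List (Fin n) → List (Fin n × Fin n) → Set where
  []  : ∀ {π} → Schedule π []
  _∷_ : ∀ {π π' p xs} → SwapPair π p π' → Schedule π' xs → Schedule π (p ∷ xs)

SamePair : {n : ℕ} → Fin n → Fin n → Fin n × Fin n → Set
SamePair u v p = p ≡ (u , v) ⊎ p ≡ (v , u)

-- HasLabel x u v t : x_{t+1} = {u,v}  (0-based list index t, i.e. label λ(uv) = toℕ t + 1).
HasLabel : {n : ℕ} → (x : List (Fin n × Fin n)) → Fin n → Fin n → Fin (length x) → Set
HasLabel x u v t = SamePair u v (lookup x t)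

TemporalClique : {n : ℕ} → List (Fin n × Fin n) → Set
TemporalClique {n} x =
  ∀ (u v : Fin n) → ¬ (u ≡ v) →
    ∃ λ (t : Fin (length x)) → HasLabel x u v t × (∀ t' → HasLabel x u v t' → t' ≡ t)

{-# OPTIONS --safe #-}
-- Project every configuration onto the three agents a, b, c (keep only them, in order).
-- The projection changes only when two of a, b, c are exchanged, i.e. only at the three
-- times λ(ab), λ(ac), λ(bc).  Say λ(ab) < λ(ac) < λ(bc) (the other order is symmetric):
-- up to λ(ab) the projection is that of π; at λ(ab) the agents a and b are adjacent in it
-- and exchange, and at λ(ac) the agent a is adjacent to c.  In a duplicate-free list, a can
-- only be next to c right after passing b if c lies on the far side of b, so b is between
-- a and c in π.
module Submission where

open import Defs
open import Data.Nat using (ℕ; _<_)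
open import Data.Fin using (Fin; toℕ)
open import Data.List using (List; []; _∷_; length)
open import Data.List.Relation.Binary.Sublist.Propositional using (_⊆_)
open import Data.Product using (_×_; _,_)
open import Data.Sum using (_⊎_)
open import Relation.Binary.PropositionalEquality using (_≡_)
open import Relation.Nullary using (¬_)

open import Data.Nat using (zero; suc; _≤_; _≤′_; ≤′-refl; ≤′-step; z≤n)
open import Data.Nat.Properties using (<⇒≢; >⇒≢; <-trans; m<n⇒m<1+n; n<1+n; ≤′⇒≤; ≤⇒≤′)
open import Data.Fin using (fromℕ<) renaming (_≟_ to _≟ᶠ_)
open import Data.Fin.Properties using (toℕ<n; toℕ-fromℕ<)
open import Data.List using (filter; lookup)
open import Data.List.Properties using (filter-accept; filter-reject)
open import Data.List.Membership.Propositional using (_∈_)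
import Data.List.Membership.DecPropositional as DecMembership
open import Data.List.Relation.Unary.All as All using ()
open import Data.List.Relation.Unary.AllPairs using (_∷_)
open import Data.List.Relation.Unary.Any using (here; there)
open import Data.List.Relation.Unary.Unique.Propositional using (Unique)
open import Data.List.Relation.Unary.Unique.Propositional.Properties using (filter⁺; Unique[x∷xs]⇒x∉xs)
open import Data.List.Relation.Binary.Sublist.Propositional using (_∷_; _∷ʳ_; minimum; ⊆-trans)
open import Data.List.Relation.Binary.Sublist.Propositional.Properties using (filter-⊆)
open import Data.Product using () renaming (swap to ×-swap)
open import Function using (_∘_; case_of_)
open import Data.Sum using (inj₁; inj₂; [_,_]′) renaming (swap to ⊎-swap; map to ⊎-map)
open import Data.Empty using (⊥-elim)
open import Level using (Level)
open import Relation.Nullary using (yes; no)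
open import Relation.Unary using (Pred; Decidable)
open import Relation.Binary.PropositionalEquality using (_≢_; refl; sym; trans; cong; subst; subst₂)
open import Relation.Binary.PropositionalEquality using (module ≡-Reasoning)

private
  variable
    n : ℕ
    a b c u v : Fin n
    l l′ l₀ l₁ l₂ : List (Fin n)

Between : Fin n → Fin n → Fin n → List (Fin n) → Set
Between a b c l = (a ∷ b ∷ c ∷ []) ⊆ l ⊎ (c ∷ b ∷ a ∷ []) ⊆ l

Between-sym : Between a b c l → Between c b a l
Between-sym = ⊎-swap

Between-⊆ : l ⊆ l′ → Between a b c l → Between a b c l′
Between-⊆ l⊆l′ = ⊎-map (λ p → ⊆-trans p l⊆l′) (λ p → ⊆-trans p l⊆l′)

AdjSwap-self⇒≡ : AdjSwap l u u l′ → l ≡ l′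
AdjSwap-self⇒≡ here      = refl
AdjSwap-self⇒≡ (there s) = cong (_ ∷_) (AdjSwap-self⇒≡ s)

AdjSwap⇒∈ˡ : AdjSwap l u v l′ → u ∈ l
AdjSwap⇒∈ˡ here      = here refl
AdjSwap⇒∈ˡ (there s) = there (AdjSwap⇒∈ˡ s)

AdjSwap⇒∈ʳ : AdjSwap l u v l′ → v ∈ l
AdjSwap⇒∈ʳ here      = there (here refl)
AdjSwap⇒∈ʳ (there s) = there (AdjSwap⇒∈ʳ s)

SwapPair-sym : SwapPair l (u , v) l′ → SwapPair l (v , u) l′
SwapPair-sym = ⊎-swap

ab-then-ac⇒abc⊆ : Unique l₀ → AdjSwap l₀ a b l₁ → AdjSwap l₁ a c l₂ → (a ∷ b ∷ c ∷ []) ⊆ l₀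
ab-then-ac⇒abc⊆ (a∉ ∷ _) here       here                = ⊥-elim (All.head a∉ refl)
ab-then-ac⇒abc⊆ _        here       (there here)        = refl ∷ refl ∷ refl ∷ minimum _
ab-then-ac⇒abc⊆ uq       here       (there (there s))   =
  ⊥-elim (Unique[x∷xs]⇒x∉xs uq (there (AdjSwap⇒∈ˡ s)))
ab-then-ac⇒abc⊆ uq       (there s₁) here                = ⊥-elim (Unique[x∷xs]⇒x∉xs uq (AdjSwap⇒∈ˡ s₁))
ab-then-ac⇒abc⊆ (_ ∷ uq) (there s₁) (there s₂)          = _ ∷ʳ ab-then-ac⇒abc⊆ uq s₁ s₂

ba-then-ca⇒cba⊆ : Unique l₀ → AdjSwap l₀ b a l₁ → AdjSwap l₁ c a l₂ → (c ∷ b ∷ a ∷ []) ⊆ l₀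
ba-then-ca⇒cba⊆ (a∉ ∷ _)     here               here              = ⊥-elim (All.head a∉ refl)
ba-then-ca⇒cba⊆ (_ ∷ a∉ ∷ _) here               (there here)      = ⊥-elim (All.head a∉ refl)
ba-then-ca⇒cba⊆ (_ ∷ uq)     here               (there (there s)) = ⊥-elim (Unique[x∷xs]⇒x∉xs uq (AdjSwap⇒∈ʳ s))
ba-then-ca⇒cba⊆ _            (there here)       here              = refl ∷ refl ∷ refl ∷ minimum _
ba-then-ca⇒cba⊆ (_ ∷ uq)     (there (there s₁)) here              = ⊥-elim (Unique[x∷xs]⇒x∉xs uq (AdjSwap⇒∈ʳ s₁))
ba-then-ca⇒cba⊆ (_ ∷ uq)     (there s₁)         (there s₂)        = _ ∷ʳ ba-then-ca⇒cba⊆ uq s₁ s₂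

ab-then-ca⇒b≡c : Unique l₀ → AdjSwap l₀ a b l₁ → AdjSwap l₁ c a l₂ → b ≡ c
ab-then-ca⇒b≡c _            here               here              = refl
ab-then-ca⇒b≡c uq           here               (there here)      = ⊥-elim (Unique[x∷xs]⇒x∉xs uq (there (here refl)))
ab-then-ca⇒b≡c uq           here               (there (there s)) =
  ⊥-elim (Unique[x∷xs]⇒x∉xs uq (there (AdjSwap⇒∈ʳ s)))
ab-then-ca⇒b≡c (_ ∷ a∉ ∷ _) (there here)       here              = ⊥-elim (All.head a∉ refl)
ab-then-ca⇒b≡c (_ ∷ uq)     (there (there s₁)) here              = ⊥-elim (Unique[x∷xs]⇒x∉xs uq (AdjSwap⇒∈ˡ s₁))
ab-then-ca⇒b≡c (_ ∷ uq)     (there s₁)         (there s₂)        = ab-then-ca⇒b≡c uq s₁ s₂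

ba-then-ac⇒b≡c : Unique l₀ → AdjSwap l₀ b a l₁ → AdjSwap l₁ a c l₂ → b ≡ c
ba-then-ac⇒b≡c _        here       here              = refl
ba-then-ac⇒b≡c (a∉ ∷ _) here       (there here)      = ⊥-elim (All.head a∉ refl)
ba-then-ac⇒b≡c (_ ∷ uq) here       (there (there s)) = ⊥-elim (Unique[x∷xs]⇒x∉xs uq (AdjSwap⇒∈ˡ s))
ba-then-ac⇒b≡c uq       (there s₁) here              = ⊥-elim (Unique[x∷xs]⇒x∉xs uq (AdjSwap⇒∈ʳ s₁))
ba-then-ac⇒b≡c (_ ∷ uq) (there s₁) (there s₂)        = ba-then-ac⇒b≡c uq s₁ s₂

swap-ab-then-ac⇒Between : Unique l₀ → b ≢ c → SwapPair l₀ (a , b) l₁ → SwapPair l₁ (a , c) l₂ →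
                          Between a b c l₀
swap-ab-then-ac⇒Between uq _   (inj₁ s₁) (inj₁ s₂) = inj₁ (ab-then-ac⇒abc⊆ uq s₁ s₂)
swap-ab-then-ac⇒Between uq b≢c (inj₁ s₁) (inj₂ s₂) = ⊥-elim (b≢c (ab-then-ca⇒b≡c uq s₁ s₂))
swap-ab-then-ac⇒Between uq b≢c (inj₂ s₁) (inj₁ s₂) = ⊥-elim (b≢c (ba-then-ac⇒b≡c uq s₁ s₂))
swap-ab-then-ac⇒Between uq _   (inj₂ s₁) (inj₂ s₂) = inj₂ (ba-then-ca⇒cba⊆ uq s₁ s₂)

InnerPair : {p : Level} → Pred (Fin n) p → Fin n × Fin n → Set p
InnerPair P (u , v) = P u × P v × u ≢ v

module _ {p : Level} {P : Pred (Fin n) p} (P? : Decidable P) where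

  open ≡-Reasoning

  filter-accept₂ : P u → P v → filter P? (u ∷ v ∷ l) ≡ u ∷ v ∷ filter P? l
  filter-accept₂ {u} Pu Pv = trans (filter-accept P? Pu) (cong (u ∷_) (filter-accept P? Pv))

  filter-swap-rejected : ¬ P u → filter P? (u ∷ v ∷ l) ≡ filter P? (v ∷ u ∷ l)
  filter-swap-rejected {u} {v} {l} ¬Pu = case P? v of λ where
    (yes Pv) → begin
      filter P? (u ∷ v ∷ l)  ≡⟨ filter-reject P? ¬Pu ⟩
      filter P? (v ∷ l)      ≡⟨ filter-accept P? Pv ⟩
      v ∷ filter P? l        ≡⟨ cong (v ∷_) (filter-reject P? ¬Pu) ⟨
      v ∷ filter P? (u ∷ l)  ≡⟨ filter-accept P? Pv ⟨
      filter P? (v ∷ u ∷ l)  ∎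
    (no ¬Pv) → begin
      filter P? (u ∷ v ∷ l)  ≡⟨ filter-reject P? ¬Pu ⟩
      filter P? (v ∷ l)      ≡⟨ filter-reject P? ¬Pv ⟩
      filter P? l            ≡⟨ filter-reject P? ¬Pu ⟨
      filter P? (u ∷ l)      ≡⟨ filter-reject P? ¬Pv ⟨
      filter P? (v ∷ u ∷ l)  ∎

  filter-AdjSwap⁺ : P u → P v → AdjSwap l u v l′ → AdjSwap (filter P? l) u v (filter P? l′)
  filter-AdjSwap⁺ Pu Pv here =
    subst₂ (λ k k′ → AdjSwap k _ _ k′) (sym (filter-accept₂ Pu Pv)) (sym (filter-accept₂ Pv Pu)) here
  filter-AdjSwap⁺ Pu Pv (there {w} s) with P? w
  ... | yes _ = there (filter-AdjSwap⁺ Pu Pv s)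
  ... | no _  = filter-AdjSwap⁺ Pu Pv s

  filter-AdjSwap-≡ : ¬ (P u × P v) → AdjSwap l u v l′ → filter P? l ≡ filter P? l′
  filter-AdjSwap-≡ {u} ¬PuPv here = case P? u of λ where
    (yes Pu) → sym (filter-swap-rejected (λ Pv → ¬PuPv (Pu , Pv)))
    (no ¬Pu) → filter-swap-rejected ¬Pu
  filter-AdjSwap-≡ ¬PuPv (there {w} s) with P? w
  ... | yes _ = cong (w ∷_) (filter-AdjSwap-≡ ¬PuPv s)
  ... | no _  = filter-AdjSwap-≡ ¬PuPv s

  filter-SwapPair⁺ : P u → P v → SwapPair l (u , v) l′ → SwapPair (filter P? l) (u , v) (filter P? l′)
  filter-SwapPair⁺ Pu Pv = ⊎-map (filter-AdjSwap⁺ Pu Pv) (filter-AdjSwap⁺ Pv Pu)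

  filter-SwapPair-≡ : ¬ InnerPair P (u , v) → SwapPair l (u , v) l′ → filter P? l ≡ filter P? l′
  filter-SwapPair-≡ {u} {v} ¬inner s with u ≟ᶠ v
  ... | yes refl = cong (filter P?) ([ AdjSwap-self⇒≡ , AdjSwap-self⇒≡ ]′ s)
  ... | no u≢v = [ filter-AdjSwap-≡ ¬PuPv , filter-AdjSwap-≡ (¬PuPv ∘ ×-swap) ]′ s
    where ¬PuPv : ¬ (P u × P v)
          ¬PuPv (Pu , Pv) = ¬inner (Pu , Pv , u≢v)

stepwise-≡ : ∀ {A : Set} (g : ℕ → A) {i j : ℕ} → i ≤ j →
             (∀ k → i ≤ k → k < j → g k ≡ g (suc k)) → g i ≡ g j
stepwise-≡ g i≤j = go (≤⇒≤′ i≤j)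
  where
  go : ∀ {i j} → i ≤′ j → (∀ k → i ≤ k → k < j → g k ≡ g (suc k)) → g i ≡ g j
  go ≤′-refl        _    = refl
  go (≤′-step i≤′j) step =
    trans (go i≤′j (λ k i≤k k<j → step k i≤k (m<n⇒m<1+n k<j))) (step _ (≤′⇒≤ i≤′j) (n<1+n _))

configuration : {π : List (Fin n)} {x : List (Fin n × Fin n)} → Schedule π x → ℕ → List (Fin n)
configuration {π = π} _       zero    = π
configuration {π = π} []      (suc _) = π
configuration         (_ ∷ s) (suc k) = configuration s k

configuration-step : {π : List (Fin n)} {x : List (Fin n × Fin n)} (s : Schedule π x)
                     (t : Fin (length x)) →
                     SwapPair (configuration s (toℕ t)) (lookup x t) (configuration s (suc (toℕ t)))
configuration-step (sw ∷ _) Fin.zero    = sw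
configuration-step (_ ∷ s)  (Fin.suc t) = configuration-step s t

configuration-swap : {π : List (Fin n)} {x : List (Fin n × Fin n)} (s : Schedule π x)
                     {t : Fin (length x)} → HasLabel x u v t →
                     SwapPair (configuration s (toℕ t)) (u , v) (configuration s (suc (toℕ t)))
configuration-swap s {t} (inj₁ x[t]≡uv) =
  subst (λ q → SwapPair _ q _) x[t]≡uv (configuration-step s t)
configuration-swap s {t} (inj₂ x[t]≡vu) =
  SwapPair-sym (subst (λ q → SwapPair _ q _) x[t]≡vu (configuration-step s t))

HasLabel-sym : {x : List (Fin n × Fin n)} {t : Fin (length x)} → HasLabel x u v t → HasLabel x v u t
HasLabel-sym = ⊎-swap

HasLabel-unique : {x : List (Fin n × Fin n)} → TemporalClique x → u ≢ v → {t t′ : Fin (length x)} →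
                  HasLabel x u v t → HasLabel x u v t′ → t ≡ t′
HasLabel-unique {u = u} {v} clique u≢v H H′ =
  let (_ , _ , unique) = clique u v u≢v in trans (unique _ H) (sym (unique _ H′))

module _ {p : Level} {P : Pred (Fin n) p} (P? : Decidable P)
         {π : List (Fin n)} {x : List (Fin n × Fin n)} (s : Schedule π x) where

  projection : ℕ → List (Fin n)
  projection k = filter P? (configuration s k)

  projection-swap : {t : Fin (length x)} → HasLabel x u v t → P u → P v →
                    SwapPair (projection (toℕ t)) (u , v) (projection (suc (toℕ t)))
  projection-swap H Pu Pv = filter-SwapPair⁺ P? Pu Pv (configuration-swap s H)

  swap-ab-then-ac⇒Between-initially :
    Unique π → P a → P b → P c → b ≢ c → {t₁ t₂ : Fin (length x)} → toℕ t₁ < toℕ t₂ →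
    HasLabel x a b t₁ → HasLabel x a c t₂ →
    (∀ k → k < toℕ t₂ → k ≢ toℕ t₁ → projection k ≡ projection (suc k)) →
    Between a b c π
  swap-ab-then-ac⇒Between-initially {a = a} {b} {c} uπ Pa Pb Pc b≢c {t₁} {t₂} t₁<t₂ H₁ H₂ quiet =
    Between-⊆ (filter-⊆ P? π) (subst (Between a b c) (sym before) at-t₁)
    where
    before : projection 0 ≡ projection (toℕ t₁)
    before = stepwise-≡ projection z≤n (λ k _ k<t₁ → quiet k (<-trans k<t₁ t₁<t₂) (<⇒≢ k<t₁))
    meanwhile : projection (suc (toℕ t₁)) ≡ projection (toℕ t₂)
    meanwhile = stepwise-≡ projection t₁<t₂ (λ k t₁<k k<t₂ → quiet k k<t₂ (>⇒≢ t₁<k))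
    at-t₁ : Between a b c (projection (toℕ t₁))
    at-t₁ = swap-ab-then-ac⇒Between (subst Unique before (filter⁺ P? uπ)) b≢c
              (projection-swap H₁ Pa Pb)
              (subst (λ l → SwapPair l (a , c) (projection (suc (toℕ t₂)))) (sym meanwhile)
                     (projection-swap H₂ Pa Pc))

∈-triangle? : (a b c : Fin n) → Decidable (_∈ a ∷ b ∷ c ∷ [])
∈-triangle? a b c u = DecMembership._∈?_ _≟ᶠ_ u (a ∷ b ∷ c ∷ [])

module _ {x : List (Fin n × Fin n)} (clique : TemporalClique x) {a b c : Fin n}
         (a≢b : a ≢ b) (a≢c : a ≢ c) (b≢c : b ≢ c) {tab tac tbc : Fin (length x)}
         (Hab : HasLabel x a b tab) (Hac : HasLabel x a c tac) (Hbc : HasLabel x b c tbc) where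

  private
    unique : u ≢ v → {t t′ : Fin (length x)} → HasLabel x u v t → HasLabel x u v t′ → t ≡ t′
    unique = HasLabel-unique {x = x} clique

    unique-sym : v ≢ u → {t t′ : Fin (length x)} → HasLabel x u v t → HasLabel x v u t′ → t ≡ t′
    unique-sym v≢u H = unique v≢u (HasLabel-sym {x = x} H)

  label-in-triangle : u ∈ a ∷ b ∷ c ∷ [] → v ∈ a ∷ b ∷ c ∷ [] → u ≢ v →
                      {t : Fin (length x)} → HasLabel x u v t → t ≡ tab ⊎ t ≡ tac ⊎ t ≡ tbc
  label-in-triangle (here refl)         (here refl)                 u≢v _ = ⊥-elim (u≢v refl)
  label-in-triangle (here refl)         (there (here refl))         _   H = inj₁ (unique a≢b H Hab)
  label-in-triangle (here refl)         (there (there (here refl))) _   H = inj₂ (inj₁ (unique a≢c H Hac))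
  label-in-triangle (there (here refl)) (here refl)                 _   H = inj₁ (unique-sym a≢b H Hab)
  label-in-triangle (there (here refl)) (there (here refl))         u≢v _ = ⊥-elim (u≢v refl)
  label-in-triangle (there (here refl)) (there (there (here refl))) _   H = inj₂ (inj₂ (unique b≢c H Hbc))
  label-in-triangle (there (there (here refl))) (here refl)         _   H = inj₂ (inj₁ (unique-sym a≢c H Hac))
  label-in-triangle (there (there (here refl))) (there (here refl)) _   H = inj₂ (inj₂ (unique-sym b≢c H Hbc))
  label-in-triangle (there (there (here refl))) (there (there (here refl))) u≢v _ = ⊥-elim (u≢v refl)

  triangle-projection-steady : {π : List (Fin n)} (s : Schedule π x) →
    ∀ k → k < length x → k ≢ toℕ tab → k ≢ toℕ tac → k ≢ toℕ tbc →
    projection (∈-triangle? a b c) s k ≡ projection (∈-triangle? a b c) s (suc k)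
  triangle-projection-steady s k k<T k≢ab k≢ac k≢bc =
    subst (λ j → projection (∈-triangle? a b c) s j ≡ projection (∈-triangle? a b c) s (suc j))
          (toℕ-fromℕ< k<T)
          (filter-SwapPair-≡ (∈-triangle? a b c) not-inner (configuration-step s t))
    where
    t : Fin (length x)
    t = fromℕ< k<T
    k-is : {t′ : Fin (length x)} → t ≡ t′ → k ≡ toℕ t′
    k-is refl = sym (toℕ-fromℕ< k<T)
    not-inner : ¬ InnerPair (_∈ a ∷ b ∷ c ∷ []) (lookup x t)
    not-inner (u∈ , v∈ , u≢v) with label-in-triangle u∈ v∈ u≢v (inj₁ refl)
    ... | inj₁ t≡ab        = k≢ab (k-is t≡ab)
    ... | inj₂ (inj₁ t≡ac) = k≢ac (k-is t≡ac)
    ... | inj₂ (inj₂ t≡bc) = k≢bc (k-is t≡bc)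

  median-label⇒Between : {π : List (Fin n)} → Unique π → Schedule π x →
                         toℕ tab < toℕ tac → toℕ tac < toℕ tbc → Between a b c π
  median-label⇒Between uπ s ab<ac ac<bc =
    swap-ab-then-ac⇒Between-initially (∈-triangle? a b c) s uπ
      (here refl) (there (here refl)) (there (there (here refl))) b≢c ab<ac Hab Hac steady
    where
    steady : ∀ k → k < toℕ tac → k ≢ toℕ tab →
             projection (∈-triangle? a b c) s k ≡ projection (∈-triangle? a b c) s (suc k)
    steady k k<ac k≢ab =
      triangle-projection-steady s k (<-trans k<ac (toℕ<n tac))
        k≢ab (<⇒≢ k<ac) (<⇒≢ (<-trans k<ac ac<bc))

mainTheorem3 : (n : ℕ) (π : List (Fin n)) (x : List (Fin n × Fin n)) →
    IsOrdering n π → Schedule π x → TemporalClique x →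
    (a b c : Fin n) → ¬ (a ≡ b) → ¬ (a ≡ c) → ¬ (b ≡ c) →
    (tab tac tbc : Fin (length x)) →
    HasLabel x a b tab → HasLabel x a c tac → HasLabel x b c tbc →
    ((toℕ tab < toℕ tac × toℕ tac < toℕ tbc) ⊎ (toℕ tbc < toℕ tac × toℕ tac < toℕ tab)) →
    ((a ∷ b ∷ c ∷ []) ⊆ π) ⊎ ((c ∷ b ∷ a ∷ []) ⊆ π)
mainTheorem3 _ _ x (uπ , _) s clique _ _ _ a≢b a≢c b≢c _ _ _ Hab Hac Hbc (inj₁ (ab<ac , ac<bc)) =
  median-label⇒Between clique a≢b a≢c b≢c Hab Hac Hbc uπ s ab<ac ac<bc
mainTheorem3 _ _ x (uπ , _) s clique _ _ _ a≢b a≢c b≢c _ _ _ Hab Hac Hbc (inj₂ (bc<ac , ac<ab)) =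
  Between-sym (median-label⇒Between clique (b≢c ∘ sym) (a≢c ∘ sym) (a≢b ∘ sym)
                 (HasLabel-sym {x = x} Hbc) (HasLabel-sym {x = x} Hac) (HasLabel-sym {x = x} Hab)
                 uπ s bc<ac ac<ab)
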